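{- Let $m = p_1^{e_1}\cdots p_r^{e_r}$, $R=\{1,\dots,r\}$, $I \subseteq R$, and let $C_I$ be the connected component of the sequential power graph of $\mathbb{Z}/m\mathbb{Z}$ containing $d_I$. Then $$C_I = \{\pi_I x \bmod m \,:\, x \in \mathbb{Z},\ \gcd(x, m/g_I) = 1\}.$$
   Context: $m = p_1^{e_1}\cdots p_r^{e_r}$ with distinct primes $p_i$, $e_i\ge 1$. For $I \subseteq R$: $\pi_I = \prod_{i\in I} p_i$ ($\pi_\emptyset=1$), $g_I = \prod_{i\in I} p_i^{e_i}$, and $d_I$ is the idempotent of $\mathbb{Z}/m\mathbb{Z}$ with $d_I \equiv 0 \pmod{p_i^{e_i}}$ for $i\in I$ and $d_I \equiv 1 \pmod{p_j^{e_j}}$ for $j \notin I$. The sequential power graph of $\mathbb{Z}/m\mathbb{Z}$ is the directed graph on $\mathbb{Z}/m\mathbb{Z}$ with an edge $(b,c)$ iff $b \equiv a^i$, $c\equiv a^{i+1} \pmod m$ for some $a$ and $i\in\mathbb{N}$; connected components are with respect to undirected paths. -}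

module Defs where

open import Data.Nat using (ℕ; zero; suc; _*_; _^_; _<_; _≤_)
open import Data.Fin using (Fin; zero; suc)
open import Data.Fin.Subset using (Subset; _∈_; _∉_)
open import Data.Fin.Subset.Properties using (_∈?_)
open import Data.Integer as ℤ using (ℤ; +_)
open import Data.Integer.Divisibility using () renaming (_∣_ to _∣ℤ_)
open import Data.Product using (Σ; _×_; ∃)
open import Relation.Nullary using (yes; no)

prodFin : (r : ℕ) → (Fin r → ℕ) → ℕ
prodFin zero    f = 1
prodFin (suc r) f = f zero * prodFin r (λ i → f (suc i))

modulus : (r : ℕ) → (Fin r → ℕ) → (Fin r → ℕ) → ℕ
modulus r p e = prodFin r (λ i → p i ^ e i)

piI : (r : ℕ) → (Fin r → ℕ) → Subset r → ℕ
piI r p I = prodFin r (λ i → helper (i ∈? I) i)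
  where
  helper : ∀ {A : Set} → Relation.Nullary.Dec A → Fin r → ℕ
  helper (yes _) i = p i
  helper (no _)  i = 1

gI : (r : ℕ) → (Fin r → ℕ) → (Fin r → ℕ) → Subset r → ℕ
gI r p e I = prodFin r (λ i → helper (i ∈? I) i)
  where
  helper : ∀ {A : Set} → Relation.Nullary.Dec A → Fin r → ℕ
  helper (yes _) i = p i ^ e i
  helper (no _)  i = 1

_≡_[mod_] : ℤ → ℤ → ℕ → Set
a ≡ b [mod n ] = (+ n) ∣ℤ (a ℤ.- b)

-- d is the idempotent d_I of Z/mZ (represented by its residue d < m)
IsIdempotentD : (r : ℕ) → (Fin r → ℕ) → (Fin r → ℕ) → Subset r → ℕ → Set
IsIdempotentD r p e I d =
  d < modulus r p e
  × (∀ i → i ∈ I → (+ d) ≡ + 0 [mod p i ^ e i ])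
  × (∀ j → j ∉ I → (+ d) ≡ + 1 [mod p j ^ e j ])

-- edge (b,c) of the sequential power graph of Z/mZ (vertices: residues 0..m-1):
-- b ≡ a^i, c ≡ a^(i+1) (mod m) for some a and some i ∈ ℕ = {1,2,...}
SPEdge : ℕ → ℕ → ℕ → Set
SPEdge m b c =
  b < m × c < m ×
  Σ ℕ λ a → Σ ℕ λ i → 1 ≤ i
    × (+ b) ≡ + (a ^ i) [mod m ]
    × (+ c) ≡ + (a ^ suc i) [mod m ]

data SPConnected (m : ℕ) (b : ℕ) : ℕ → Set where
  here : SPConnected m b b
  fwd  : ∀ {c d} → SPConnected m b c → SPEdge m c d → SPConnected m b d
  bwd  : ∀ {c d} → SPConnected m b c → SPEdge m d c → SPConnected m b d

module Submission where

-- Both sides are characterised by one invariant, the support of c: the set of i with p_i ∣ c.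
--  * Support is constant along edges (a^k, a^(k+1)), since p ∣ a^k ⇔ p ∣ a; d_I has support I,
--    so every element of C_I has support I.
--  * Conversely, if c has support I then some power f = c^N mod m is idempotent (the powers of c
--    are eventually periodic).  Locally f ≡ 0 or 1 mod p_i^e_i, according to whether p_i ∣ f,
--    i.e. whether i ∈ I; so f and d_I agree modulo every p_i^e_i and hence, by the CRT, f = d_I.
--    The edges (c^k, c^(k+1)) then join c = c^1 to f = d_I.
--  * Support I is equivalent to the right-hand side: π_I ∣ c by the CRT, and c / π_I is prime to
--    m/g_I = ∏_{i∉I} p_i^e_i; conversely p_i ∣ π_I x forces p_i ∣ π_I or p_i ∣ x.

open import Defs
open import Data.Nat.Primality using (Prime)
open import Data.Fin.Subset using (Subset)
open import Data.Integer as ℤ using (ℤ; +_)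
open import Data.Integer.GCD using () renaming (gcd to gcdℤ)
open import Data.Product using (Σ; _×_)
open import Function using (_⇔_)
open import Function.Definitions using (Injective)
open import Relation.Binary.PropositionalEquality using (_≡_)

open import Data.Nat
open import Data.Nat.Properties
open import Data.Nat.Divisibility
open import Data.Nat.DivMod using (_%_; _/_; m≡m%n+[m/n]*n; m%n<n; %-distribˡ-*; m<n⇒m%n≡m)
open import Data.Nat.GCD using (gcd; gcd[m,n]∣m; gcd[m,n]∣n; gcd-greatest; gcd[m,n]≢0)
open import Data.Nat.Primality
open import Data.Nat.Primality.Factorisation using (factorise)
open import Data.Nat.Tactic.RingSolver using (solve-∀)
open import Data.Fin using (Fin; zero; suc; toℕ; fromℕ<)
import Data.Fin.Properties as Fin
open import Data.Fin.Subset using (_∈_; _∉_; ∁)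
open import Data.Fin.Subset.Properties using (_∈?_; x∈∁p⇒x∉p; x∉p⇒x∈∁p)
open import Data.List using ([]; _∷_)
open import Data.List.Relation.Unary.All using (_∷_)
import Data.Integer.Properties as ℤP
import Data.Integer.Divisibility.Signed as ℤS
import Data.Integer.Tactic.RingSolver as ℤSolver
open import Data.Product
open import Data.Sum using (_⊎_; inj₁; inj₂)
open import Data.Empty using (⊥-elim)
open import Function using (mk⇔; Equivalence)
open import Function.Properties.Equivalence using () renaming (sym to ⇔-sym; trans to ⇔-trans)
open import Relation.Nullary
open import Relation.Binary.PropositionalEquality

prime∤1 : ∀ {q} → Prime q → ¬ q ∣ 1
prime∤1 q-prime q∣1 = ¬prime[1] (subst Prime (∣1⇒≡1 q∣1) q-prime)

prime∣prime⇒≡ : ∀ {q p} → Prime q → Prime p → q ∣ p → q ≡ p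
prime∣prime⇒≡ q-prime p-prime q∣p with prime⇒irreducible p-prime q∣p
... | inj₁ q≡1 = ⊥-elim (¬prime[1] (subst Prime q≡1 q-prime))
... | inj₂ q≡p = q≡p

prime∣^⇒∣ : ∀ {q} → Prime q → ∀ a n → q ∣ a ^ n → q ∣ a
prime∣^⇒∣ q-prime a zero    q∣1 = ⊥-elim (prime∤1 q-prime q∣1)
prime∣^⇒∣ q-prime a (suc n) q∣aⁿ⁺¹ with euclidsLemma a (a ^ n) q-prime q∣aⁿ⁺¹
... | inj₁ q∣a  = q∣a
... | inj₂ q∣aⁿ = prime∣^⇒∣ q-prime a n q∣aⁿ

∣^ : ∀ x {k} → 1 ≤ k → x ∣ x ^ k
∣^ x {suc k} _ = m∣m*n (x ^ k)

prime∣^⇔∣ : ∀ {q} → Prime q → ∀ a {k} → 1 ≤ k → q ∣ a ^ k ⇔ q ∣ a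
prime∣^⇔∣ q-prime a {k} 1≤k = mk⇔ (prime∣^⇒∣ q-prime a k) (λ q∣a → ∣-trans q∣a (∣^ a 1≤k))

prime^-cancel : ∀ {p a} → Prime p → ¬ p ∣ a → ∀ n b → p ^ n ∣ a * b → p ^ n ∣ b
prime^-cancel p-prime p∤a zero b _ = 1∣ b
prime^-cancel {p} {a} p-prime p∤a (suc n) b pⁿ⁺¹∣ab
  with euclidsLemma a b p-prime (∣-trans (m∣m*n (p ^ n)) pⁿ⁺¹∣ab)
... | inj₁ p∣a = ⊥-elim (p∤a p∣a)
... | inj₂ (divides b′ refl) =
  subst (_∣ b′ * p) (*-comm (p ^ n) p) (*-monoˡ-∣ p (prime^-cancel p-prime p∤a n b′ pⁿ∣ab′))
  where
  instance
    p-nonZero : NonZero p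
    p-nonZero = prime⇒nonZero p-prime
  pⁿ∣ab′ : p ^ n ∣ a * b′
  pⁿ∣ab′ = *-cancelˡ-∣ p
    (subst (p * p ^ n ∣_) (trans (sym (*-assoc a b′ p)) (*-comm (a * b′) p)) pⁿ⁺¹∣ab)

one-or-prime-divisor : ∀ n .{{_ : NonZero n}} → n ≡ 1 ⊎ ∃ λ q → Prime q × q ∣ n
one-or-prime-divisor n with factorise n
... | record { factors = [] ; isFactorisation = n≡1 } = inj₁ n≡1
... | record { factors = q ∷ _ ; isFactorisation = n≡q*_ ; factorsPrime = q-prime ∷ _ } =
  inj₂ (q , q-prime , subst (q ∣_) (sym n≡q*_) (m∣m*n _))

prodFin-cong : ∀ r {f g : Fin r → ℕ} → (∀ i → f i ≡ g i) → prodFin r f ≡ prodFin r g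
prodFin-cong zero    f≗g = refl
prodFin-cong (suc r) f≗g = cong₂ _*_ (f≗g zero) (prodFin-cong r (λ i → f≗g (suc i)))

prodFin-* : ∀ r (f g : Fin r → ℕ) → prodFin r f * prodFin r g ≡ prodFin r (λ i → f i * g i)
prodFin-* zero    f g = refl
prodFin-* (suc r) f g = begin
  (f zero * F) * (g zero * G) ≡⟨ interchange (f zero) F (g zero) G ⟩
  (f zero * g zero) * (F * G) ≡⟨ cong (f zero * g zero *_) (prodFin-* r _ _) ⟩
  (f zero * g zero) * prodFin r (λ i → f (suc i) * g (suc i)) ∎
  where
  open ≡-Reasoning
  F G : ℕ
  F = prodFin r (λ i → f (suc i))
  G = prodFin r (λ i → g (suc i))
  interchange : ∀ a b c d → (a * b) * (c * d) ≡ (a * c) * (b * d)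
  interchange = solve-∀

factor∣prodFin : ∀ r (f : Fin r → ℕ) i → f i ∣ prodFin r f
factor∣prodFin (suc r) f zero    = m∣m*n _
factor∣prodFin (suc r) f (suc i) = ∣-trans (factor∣prodFin r (λ j → f (suc j)) i) (n∣m*n (f zero))

prime∣prodFin : ∀ {q} → Prime q → ∀ r (f : Fin r → ℕ) → q ∣ prodFin r f → ∃ λ j → q ∣ f j
prime∣prodFin q-prime zero    f q∣1 = ⊥-elim (prime∤1 q-prime q∣1)
prime∣prodFin q-prime (suc r) f q∣∏ with euclidsLemma (f zero) _ q-prime q∣∏
... | inj₁ q∣f₀ = zero , q∣f₀
... | inj₂ q∣rest with prime∣prodFin q-prime r (λ j → f (suc j)) q∣rest
...   | j , q∣fⱼ₊₁ = suc j , q∣fⱼ₊₁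

prodFin-nonZero : ∀ r (f : Fin r → ℕ) → (∀ i → NonZero (f i)) → NonZero (prodFin r f)
prodFin-nonZero zero    f nz = _
prodFin-nonZero (suc r) f nz = m*n≢0 (f zero) _ {{nz zero}} {{prodFin-nonZero r _ (λ i → nz (suc i))}}

PowersOf : ∀ {r} → (Fin r → ℕ) → (Fin r → ℕ) → Set
PowersOf p f = ∀ i → ∃ λ n → f i ≡ p i ^ n

crt : ∀ r (p f : Fin r → ℕ) → (∀ i → Prime (p i)) → Injective _≡_ _≡_ p → PowersOf p f
    → ∀ X → (∀ i → f i ∣ X) → prodFin r f ∣ X
crt zero    p f p-prime p-inj f-pow X f∣X = 1∣ X
crt (suc r) p f p-prime p-inj f-pow X f∣X
  with crt r (λ i → p (suc i)) (λ i → f (suc i)) (λ i → p-prime (suc i))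
           (λ eq → Fin.suc-injective (p-inj eq)) (λ i → f-pow (suc i)) X (λ i → f∣X (suc i))
     | f-pow zero
... | divides q refl | n , f₀≡pⁿ =
  *-monoˡ-∣ rest (subst (_∣ q) (sym f₀≡pⁿ) (prime^-cancel (p-prime zero) p₀∤rest n q pⁿ∣rest*q))
  where
  rest : ℕ
  rest = prodFin r (λ i → f (suc i))
  pⁿ∣rest*q : p zero ^ n ∣ rest * q
  pⁿ∣rest*q = subst₂ _∣_ f₀≡pⁿ (*-comm q rest) (f∣X zero)
  -- p₀ divides no other factor, since those are powers of primes different from p₀
  p₀∤rest : ¬ p zero ∣ rest
  p₀∤rest p₀∣rest with prime∣prodFin (p-prime zero) r (λ i → f (suc i)) p₀∣rest
  ... | j , p₀∣fⱼ with f-pow (suc j)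
  ...   | k , fⱼ≡pⱼᵏ with p-inj (prime∣prime⇒≡ (p-prime zero) (p-prime (suc j))
                           (prime∣^⇒∣ (p-prime zero) _ k (subst (_ ∣_) fⱼ≡pⱼᵏ p₀∣fⱼ)))
  ...     | ()

select : ∀ {A : Set} → Dec A → ℕ → ℕ
select (yes _) x = x
select (no _)  x = 1

subProd : ∀ r → Subset r → (Fin r → ℕ) → ℕ
subProd r I f = prodFin r (λ i → select (i ∈? I) (f i))

-- Their factors are given by a local helper
-- of Defs; it is named here as proj₁ of the trivial decomposition 'unfolded', after which
-- 'with i ∈? I' computes it.
piI≡subProd : ∀ r p I → piI r p I ≡ subProd r I p
piI≡subProd r p I = prodFin-cong r factor
  where
  unfolded : Σ (Fin r → ℕ) λ f → piI r p I ≡ prodFin r f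
  unfolded = _ , refl
  factor : ∀ i → proj₁ unfolded i ≡ select (i ∈? I) (p i)
  factor i with i ∈? I
  ... | yes _ = refl
  ... | no _  = refl

gI≡subProd : ∀ r p e I → gI r p e I ≡ subProd r I (λ i → p i ^ e i)
gI≡subProd r p e I = prodFin-cong r factor
  where
  unfolded : Σ (Fin r → ℕ) λ f → gI r p e I ≡ prodFin r f
  unfolded = _ , refl
  factor : ∀ i → proj₁ unfolded i ≡ select (i ∈? I) (p i ^ e i)
  factor i with i ∈? I
  ... | yes _ = refl
  ... | no _  = refl

subProd-split : ∀ r I f → subProd r I f * subProd r (∁ I) f ≡ prodFin r f
subProd-split r I f = trans (prodFin-* r _ _) (prodFin-cong r factor)
  where
  factor : ∀ i → select (i ∈? I) (f i) * select (i ∈? ∁ I) (f i) ≡ f i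
  factor i with i ∈? I | i ∈? ∁ I
  ... | yes i∈I | yes i∈∁I = ⊥-elim (x∈∁p⇒x∉p i∈∁I i∈I)
  ... | yes _   | no _     = *-identityʳ (f i)
  ... | no _    | yes _    = *-identityˡ (f i)
  ... | no i∉I  | no i∉∁I  = ⊥-elim (i∉∁I (x∉p⇒x∈∁p i∉I))

factor∣subProd : ∀ r I f {i} → i ∈ I → f i ∣ subProd r I f
factor∣subProd r I f {i} i∈I with i ∈? I | factor∣prodFin r (λ j → select (j ∈? I) (f j)) i
... | yes _  | fᵢ∣∏ = fᵢ∣∏
... | no i∉I | _    = ⊥-elim (i∉I i∈I)

prime∣subProd : ∀ {q} → Prime q → ∀ r I f → q ∣ subProd r I f → ∃ λ j → j ∈ I × q ∣ f j
prime∣subProd q-prime r I f q∣∏ with prime∣prodFin q-prime r _ q∣∏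
... | j , q∣factor with j ∈? I
...   | yes j∈I = j , j∈I , q∣factor
...   | no _    = ⊥-elim (prime∤1 q-prime q∣factor)

select-powersOf : ∀ {r} (p f : Fin r → ℕ) I → PowersOf p f → PowersOf p (λ i → select (i ∈? I) (f i))
select-powersOf p f I f-pow i with i ∈? I
... | yes _ = f-pow i
... | no _  = 0 , refl

mod-refl : ∀ {n} a → a ≡ a [mod n ]
mod-refl {n} a = subst (λ z → n ∣ ℤ.∣ z ∣) (sym (ℤP.+-inverseʳ a)) (n ∣0)

mod-sym : ∀ {n} a b → a ≡ b [mod n ] → b ≡ a [mod n ]
mod-sym {n} a b = subst (n ∣_) (ℤP.∣i-j∣≡∣j-i∣ a b)

mod-trans : ∀ {n} a b c → a ≡ b [mod n ] → b ≡ c [mod n ] → a ≡ c [mod n ]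
mod-trans {n} a b c a≡b b≡c =
  ℤS.∣⇒∣ᵤ {+ n} {a ℤ.- c} (subst ((+ n) ℤS.∣_) (telescope a b c)
    (ℤS.∣m∣n⇒∣m+n (ℤS.∣ᵤ⇒∣ {+ n} {a ℤ.- b} a≡b) (ℤS.∣ᵤ⇒∣ {+ n} {b ℤ.- c} b≡c)))
  where
  telescope : ∀ a b c → (a ℤ.- b) ℤ.+ (b ℤ.- c) ≡ a ℤ.- c
  telescope = ℤSolver.solve-∀

mod-divisors : ∀ {k n} a b → k ∣ n → a ≡ b [mod n ] → k ∣ ℤ.∣ a ∣ ⇔ k ∣ ℤ.∣ b ∣
mod-divisors {k} {n} a b k∣n a≡b = mk⇔ (transfer {b} {a} (mod-sym a b a≡b)) (transfer {a} {b} a≡b)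
  where
  transfer : ∀ {a b} → a ≡ b [mod _ ] → k ∣ ℤ.∣ b ∣ → k ∣ ℤ.∣ a ∣
  transfer {a} {b} a≡b k∣b =
    ℤS.∣⇒∣ᵤ {+ k} {a} (ℤS.∣m+n∣n⇒∣m (ℤS.∣ᵤ⇒∣ {+ k} {a ℤ.- b} (∣-trans k∣n a≡b))
                                    (ℤS.∣m⇒∣-m (ℤS.∣ᵤ⇒∣ {+ k} {b} k∣b)))

mod-reduce : ∀ n .{{_ : NonZero n}} x → (+ (x % n)) ≡ (+ x) [mod n ]
mod-reduce n x = subst (n ∣_) (sym ∣r-x∣≡qn) (n∣m*n (x / n))
  where
  r q : ℕ
  r = x % n
  q = x / n * n
  cancel : ∀ a b → a ℤ.- (a ℤ.+ b) ≡ ℤ.- b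
  cancel = ℤSolver.solve-∀
  ∣r-x∣≡qn : ℤ.∣ (+ r) ℤ.- (+ x) ∣ ≡ x / n * n
  x≡r+q : + x ≡ + r ℤ.+ + q
  x≡r+q = trans (cong +_ (m≡m%n+[m/n]*n x n)) (ℤP.pos-+ r q)
  ∣r-x∣≡qn = begin
    ℤ.∣ + r ℤ.- + x ∣          ≡⟨ cong (λ z → ℤ.∣ + r ℤ.- z ∣) x≡r+q ⟩
    ℤ.∣ + r ℤ.- (+ r ℤ.+ + q) ∣ ≡⟨ cong ℤ.∣_∣ (cancel (+ r) (+ q)) ⟩
    ℤ.∣ ℤ.- + q ∣              ≡⟨ ℤP.∣-i∣≡∣i∣ (+ q) ⟩
    q                          ∎
    where open ≡-Reasoning

mod-unique : ∀ {n a b} → a < n → b < n → (+ a) ≡ (+ b) [mod n ] → a ≡ b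
mod-unique {n} {a} {b} a<n b<n a≡b =
  ℤP.+-injective (ℤP.i-j≡0⇒i≡j (+ a) (+ b) (ℤP.∣i∣≡0⇒i≡0 (multiple-below distance<n a≡b)))
  where
  distance<n : ℤ.∣ (+ a) ℤ.- (+ b) ∣ < n
  distance<n = ≤-<-trans (subst (_≤ a ⊔ b) (cong ℤ.∣_∣ (sym (ℤP.m-n≡m⊖n a b))) (ℤP.∣m⊝n∣≤m⊔n a b))
                         (⊔-lub a<n b<n)
  multiple-below : ∀ {d} → d < n → n ∣ d → d ≡ 0
  multiple-below {zero}  _   _   = refl
  multiple-below {suc d} d<n n∣d = ⊥-elim (>⇒∤ d<n n∣d)

-- Consecutive ones (k ≥ 1) are joined by
-- an edge of the sequential power graph, and some power is idempotent: the sequence is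
-- eventually periodic (pigeonhole), and a power whose exponent is a multiple of the period,
-- beyond the pre-period, is idempotent.
module Powers (n : ℕ) .{{_ : NonZero n}} (c : ℕ) where

  P : ℕ → ℕ
  P k = c ^ k % n

  power-edge : ∀ k → SPEdge n (P (suc k)) (P (suc (suc k)))
  power-edge k = m%n<n _ n , m%n<n _ n , c , suc k , s≤s z≤n
               , mod-reduce n (c ^ suc k) , mod-reduce n (c ^ suc (suc k))

  connected-to-P1 : ∀ {b} k → SPConnected n b (P (suc k)) → SPConnected n b (P 1)
  connected-to-P1 zero    b~P1   = b~P1
  connected-to-P1 (suc k) b~Pk+2 = connected-to-P1 k (bwd b~Pk+2 (power-edge k))

  shift : ∀ t {a b} → P a ≡ P b → P (t + a) ≡ P (t + b)
  shift t {a} {b} Pa≡Pb = begin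
    c ^ (t + a) % n                 ≡⟨ cong (_% n) (^-distribˡ-+-* c t a) ⟩
    (c ^ t * c ^ a) % n             ≡⟨ %-distribˡ-* (c ^ t) (c ^ a) n ⟩
    ((c ^ t % n) * P a) % n         ≡⟨ cong (λ z → ((c ^ t % n) * z) % n) Pa≡Pb ⟩
    ((c ^ t % n) * P b) % n         ≡⟨ %-distribˡ-* (c ^ t) (c ^ b) n ⟨
    (c ^ t * c ^ b) % n             ≡⟨ cong (_% n) (^-distribˡ-+-* c t b) ⟨
    c ^ (t + b) % n                 ∎
    where open ≡-Reasoning

  repetition : ∃₂ λ s L → P (suc s) ≡ P (suc s + suc L)
  repetition with Fin.pigeonhole (n<1+n n) (λ k → fromℕ< (m%n<n (c ^ suc (toℕ k)) n))
  ... | i , j , i<j , same-residue = toℕ i , toℕ j ∸ suc (toℕ i) , trans Pi≡Pj (cong P (sym j-split))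
    where
    Pi≡Pj : P (suc (toℕ i)) ≡ P (suc (toℕ j))
    Pi≡Pj = trans (sym (Fin.toℕ-fromℕ< (m%n<n (c ^ suc (toℕ i)) n)))
              (trans (cong toℕ same-residue) (Fin.toℕ-fromℕ< (m%n<n (c ^ suc (toℕ j)) n)))
    j-split : suc (toℕ i) + suc (toℕ j ∸ suc (toℕ i)) ≡ suc (toℕ j)
    j-split = cong suc (trans (+-suc (toℕ i) _) (m+[n∸m]≡n i<j))

  module _ {a ℓ : ℕ} (period : P a ≡ P (a + ℓ)) where

    periodic : ∀ t → a ≤ t → P (t + ℓ) ≡ P t
    periodic t a≤t = begin
      P (t + ℓ)             ≡⟨ cong (λ z → P (z + ℓ)) (sym (m∸n+n≡m a≤t)) ⟩
      P ((t ∸ a) + a + ℓ)   ≡⟨ cong P (+-assoc (t ∸ a) a ℓ) ⟩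
      P ((t ∸ a) + (a + ℓ)) ≡⟨ shift (t ∸ a) (sym period) ⟩
      P ((t ∸ a) + a)       ≡⟨ cong P (m∸n+n≡m a≤t) ⟩
      P t                   ∎
      where open ≡-Reasoning

    periodic-multiple : ∀ t → a ≤ t → ∀ j → P (t + j * ℓ) ≡ P t
    periodic-multiple t a≤t zero    = cong P (+-identityʳ t)
    periodic-multiple t a≤t (suc j) = begin
      P (t + (ℓ + j * ℓ)) ≡⟨ cong P (reorder t ℓ (j * ℓ)) ⟩
      P (t + j * ℓ + ℓ)   ≡⟨ periodic (t + j * ℓ) (≤-trans a≤t (m≤m+n t (j * ℓ))) ⟩
      P (t + j * ℓ)       ≡⟨ periodic-multiple t a≤t j ⟩
      P t                 ∎
      where
      open ≡-Reasoning
      reorder : ∀ x y z → x + (y + z) ≡ x + z + y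
      reorder = solve-∀

  -- With period ℓ from a on, P N for N = a ℓ satisfies P (2N) = P N.
  idempotent-power : ∃ λ k → (P (suc k) * P (suc k)) % n ≡ P (suc k)
  idempotent-power with repetition
  ... | s , L , period = L + s * suc L , (begin
    (P N * P N) % n         ≡⟨ %-distribˡ-* (c ^ N) (c ^ N) n ⟨
    (c ^ N * c ^ N) % n     ≡⟨ cong (_% n) (^-distribˡ-+-* c N N) ⟨
    P (N + suc s * suc L)   ≡⟨ periodic-multiple period N (m≤m*n (suc s) (suc L)) (suc s) ⟩
    P N                     ∎)
    where
    open ≡-Reasoning
    N : ℕ
    N = suc s * suc L

module Component (r : ℕ) (p e : Fin r → ℕ) (p-prime : ∀ i → Prime (p i))
                 (p-inj : Injective _≡_ _≡_ p) (e≥1 : ∀ i → 1 ≤ e i) (I : Subset r) where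

  m : ℕ
  m = modulus r p e

  pe : Fin r → ℕ
  pe i = p i ^ e i

  instance
    m-nonZero : NonZero m
    m-nonZero = prodFin-nonZero r pe (λ i → m^n≢0 (p i) (e i) {{prime⇒nonZero (p-prime i)}})

  p∣pe : ∀ i → p i ∣ pe i
  p∣pe i = ∣^ (p i) (e≥1 i)

  p∣m : ∀ i → p i ∣ m
  p∣m i = ∣-trans (p∣pe i) (factor∣prodFin r pe i)

  crt-subset : ∀ J (f : Fin r → ℕ) → PowersOf p f
             → ∀ X → (∀ i → i ∈ J → f i ∣ X) → subProd r J f ∣ X
  crt-subset J f f-pow X f∣X = crt r p _ p-prime p-inj (select-powersOf p f J f-pow) X factor∣X
    where
    factor∣X : ∀ i → select (i ∈? J) (f i) ∣ X
    factor∣X i with i ∈? J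
    ... | yes i∈J = f∣X i i∈J
    ... | no _    = 1∣ X

  crt-m : ∀ X → (∀ i → pe i ∣ X) → m ∣ X
  crt-m = crt r p pe p-prime p-inj (λ i → e i , refl)

  Support : ℕ → Set
  Support c = ∀ i → i ∈ I ⇔ p i ∣ c

  -- Along an edge (a^k, a^(k+1)) both ends are divisible by the same p_i as a.
  edge-primes : ∀ {b c} → SPEdge m b c → ∀ i → p i ∣ b ⇔ p i ∣ c
  edge-primes (_ , _ , a , k , 1≤k , b≡aᵏ , c≡aᵏ⁺¹) i =
    ⇔-trans (mod-divisors (+ _) (+ (a ^ k)) (p∣m i) b≡aᵏ)
   (⇔-trans (prime∣^⇔∣ (p-prime i) a {k} 1≤k)
   (⇔-trans (⇔-sym (prime∣^⇔∣ (p-prime i) a {suc k} (s≤s z≤n)))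
            (⇔-sym (mod-divisors (+ _) (+ (a ^ suc k)) (p∣m i) c≡aᵏ⁺¹))))

  idempotentD-support : ∀ {d} → IsIdempotentD r p e I d → Support d
  idempotentD-support {d} (_ , d≡0 , d≡1) i = mk⇔ divides-d in-I
    where
    divides-d : i ∈ I → p i ∣ d
    divides-d i∈I = Equivalence.from (mod-divisors (+ d) (+ 0) (p∣pe i) (d≡0 i i∈I)) (p i ∣0)
    in-I : p i ∣ d → i ∈ I
    in-I p∣d with i ∈? I
    ... | yes i∈I = i∈I
    ... | no i∉I  = ⊥-elim (prime∤1 (p-prime i)
                      (Equivalence.to (mod-divisors (+ d) (+ 1) (p∣pe i) (d≡1 i i∉I)) p∣d))

  connected-support : ∀ {d c} → IsIdempotentD r p e I d → SPConnected m d c → Support c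
  connected-support dI here            i = idempotentD-support dI i
  connected-support dI (fwd path edge) i = ⇔-trans (connected-support dI path i) (edge-primes edge i)
  connected-support dI (bwd path edge) i =
    ⇔-trans (connected-support dI path i) (⇔-sym (edge-primes edge i))

  π g h : ℕ
  π = piI r p I
  g = gI r p e I
  -- the cofactor m / g_I = ∏_{i ∉ I} p_i ^ e_i
  h = subProd r (∁ I) pe

  g*h≡m : g * h ≡ m
  g*h≡m = trans (cong (_* h) (gI≡subProd r p e I)) (subProd-split r I pe)

  instance
    h-nonZero : NonZero h
    h-nonZero = m*n≢0⇒n≢0 g {{subst NonZero (sym g*h≡m) m-nonZero}}

  cofactor-unique : ∀ k → g * k ≡ m → k ≡ h
  cofactor-unique k g*k≡m = *-cancelˡ-≡ k h g {{g-nonZero}} (trans g*k≡m (sym g*h≡m))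
    where g-nonZero = m*n≢0⇒m≢0 g {{subst NonZero (sym g*h≡m) m-nonZero}}

  p∣h : ∀ {i} → i ∉ I → p i ∣ h
  p∣h {i} i∉I = ∣-trans (p∣pe i) (factor∣subProd r (∁ I) pe (x∉p⇒x∈∁p i∉I))

  UnitMultipleOfπ : ℕ → Set
  UnitMultipleOfπ c = Σ ℤ λ x → (∀ k → g * k ≡ m → gcdℤ x (+ k) ≡ + 1)
                              × (+ c) ≡ (+ π) ℤ.* x [mod m ]

  p∣π⇒∈ : ∀ {i} → p i ∣ π → i ∈ I
  p∣π⇒∈ {i} p∣π with prime∣subProd (p-prime i) r I p (subst (p i ∣_) (piI≡subProd r p I) p∣π)
  ... | j , j∈I , pᵢ∣pⱼ = subst (_∈ I) (sym i≡j) j∈I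
    where
    i≡j : i ≡ j
    i≡j = p-inj (prime∣prime⇒≡ (p-prime i) (p-prime j) pᵢ∣pⱼ)

  ∈⇒p∣π : ∀ {i} → i ∈ I → p i ∣ π
  ∈⇒p∣π i∈I = subst (_ ∣_) (sym (piI≡subProd r p I)) (factor∣subProd r I p i∈I)

  -- p_i ∣ c ⇔ p_i ∣ π_I x; for i ∉ I this forces p_i ∣ x, impossible as x is prime to m/g_I.
  unitMultiple⇒support : ∀ {c} → UnitMultipleOfπ c → Support c
  unitMultiple⇒support {c} (x , x-unit , c≡πx) i = mk⇔ divides-c in-I
    where
    c-vs-πx : p i ∣ c ⇔ p i ∣ π * ℤ.∣ x ∣
    c-vs-πx = subst (λ z → p i ∣ c ⇔ p i ∣ z) (ℤP.abs-* (+ π) x)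
                (mod-divisors (+ c) (+ π ℤ.* x) (p∣m i) c≡πx)
    divides-c : i ∈ I → p i ∣ c
    divides-c i∈I = Equivalence.from c-vs-πx (∣m⇒∣m*n ℤ.∣ x ∣ (∈⇒p∣π i∈I))
    in-I : p i ∣ c → i ∈ I
    in-I p∣c with euclidsLemma π ℤ.∣ x ∣ (p-prime i) (Equivalence.to c-vs-πx p∣c) | i ∈? I
    ... | inj₁ p∣π | _       = p∣π⇒∈ p∣π
    ... | inj₂ _   | yes i∈I = i∈I
    ... | inj₂ p∣x | no i∉I  =
      ⊥-elim (prime∤1 (p-prime i) (subst (p i ∣_) gcd≡1 (gcd-greatest p∣x (p∣h i∉I))))
      where
      gcd≡1 : gcd ℤ.∣ x ∣ h ≡ 1
      gcd≡1 = ℤP.+-injective (x-unit h g*h≡m)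

  support⇒π∣ : ∀ {c} → Support c → π ∣ c
  support⇒π∣ {c} c-support = subst (_∣ c) (sym (piI≡subProd r p I))
    (crt-subset I p (λ i → 1 , sym (*-identityʳ (p i))) c (λ i → Equivalence.to (c-support i)))

  -- If only p_j with j ∈ I divide y, then y is coprime to the cofactor h = ∏_{j ∉ I} p_j ^ e_j:
  -- a common prime divisor would be some p_j with j ∉ I.
  coprime-to-cofactor : ∀ y → (∀ j → p j ∣ y → j ∈ I) → gcd y h ≡ 1
  coprime-to-cofactor y y-primes
    with one-or-prime-divisor (gcd y h) {{≢-nonZero (gcd[m,n]≢0 y h (inj₂ (≢-nonZero⁻¹ h)))}}
  ... | inj₁ gcd≡1 = gcd≡1
  ... | inj₂ (q , q-prime , q∣gcd)
    with prime∣subProd q-prime r (∁ I) pe (∣-trans q∣gcd (gcd[m,n]∣n y h))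
  ...   | j , j∈∁I , q∣pⱼᵉ = ⊥-elim (x∈∁p⇒x∉p j∈∁I (y-primes j pⱼ∣y))
    where
    q≡pⱼ : q ≡ p j
    q≡pⱼ = prime∣prime⇒≡ q-prime (p-prime j) (prime∣^⇒∣ q-prime (p j) (e j) q∣pⱼᵉ)
    pⱼ∣y : p j ∣ y
    pⱼ∣y = subst (_∣ y) q≡pⱼ (∣-trans q∣gcd (gcd[m,n]∣m y h))

  support⇒unitMultiple : ∀ {c} → Support c → UnitMultipleOfπ c
  support⇒unitMultiple {c} c-support with support⇒π∣ c-support
  ... | divides y c≡yπ = + y , y-unit , subst (λ z → (+ c) ≡ z [mod m ]) c≡πy (mod-refl (+ c))
    where
    c≡πy : + c ≡ + π ℤ.* + y
    c≡πy = trans (cong +_ (trans c≡yπ (*-comm y π))) (ℤP.pos-* π y)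
    y-primes : ∀ j → p j ∣ y → j ∈ I
    y-primes j pⱼ∣y = Equivalence.from (c-support j) (subst (_ ∣_) (sym c≡yπ) (∣m⇒∣m*n π pⱼ∣y))
    y-unit : ∀ k → g * k ≡ m → gcdℤ (+ y) (+ k) ≡ + 1
    y-unit k g*k≡m =
      cong +_ (subst (λ k → gcd y k ≡ 1) (sym (cofactor-unique k g*k≡m))
                     (coprime-to-cofactor y y-primes))

  LocallyIdempotent : ℕ → Set
  LocallyIdempotent u = (∀ i → i ∈ I → (+ u) ≡ + 0 [mod pe i ])
                      × (∀ i → i ∉ I → (+ u) ≡ + 1 [mod pe i ])

  -- By the CRT there is only one such residue below m.
  locallyIdempotent-unique : ∀ {u v} → u < m → v < m
                           → LocallyIdempotent u → LocallyIdempotent v → u ≡ v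
  locallyIdempotent-unique {u} {v} u<m v<m (u≡0 , u≡1) (v≡0 , v≡1) =
    mod-unique u<m v<m (crt-m _ local)
    where
    local : ∀ i → pe i ∣ ℤ.∣ (+ u) ℤ.- (+ v) ∣
    local i with i ∈? I
    ... | yes i∈I = mod-trans (+ u) (+ 0) (+ v) (u≡0 i i∈I) (mod-sym (+ v) (+ 0) (v≡0 i i∈I))
    ... | no i∉I  = mod-trans (+ u) (+ 1) (+ v) (u≡1 i i∉I) (mod-sym (+ v) (+ 1) (v≡1 i i∉I))

  -- An idempotent residue f with support I is locally 0 or 1 according to I: from
  -- p_i ^ e_i ∣ f (f - 1) the factor not divisible by p_i can be cancelled.
  idempotent-locallyIdempotent : ∀ {f} → Support f → (+ f) ≡ + (f * f) [mod m ] → LocallyIdempotent f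
  idempotent-locallyIdempotent {f} f-support f≡f² = at-I , off-I
    where
    pe∣f[f-1] : ∀ i → pe i ∣ f * ℤ.∣ (+ f) ℤ.- + 1 ∣
    pe∣f[f-1] i = ∣-trans (factor∣prodFin r pe i)
      (subst (m ∣_) f²-f≡f[f-1] (mod-sym (+ f) (+ (f * f)) f≡f²))
      where
      factor : ∀ a → a ℤ.* a ℤ.- a ≡ a ℤ.* (a ℤ.- + 1)
      factor = ℤSolver.solve-∀
      f²-f≡f[f-1] : ℤ.∣ + (f * f) ℤ.- + f ∣ ≡ f * ℤ.∣ (+ f) ℤ.- + 1 ∣
      f²-f≡f[f-1] = begin
        ℤ.∣ + (f * f) ℤ.- + f ∣      ≡⟨ cong (λ z → ℤ.∣ z ℤ.- + f ∣) (ℤP.pos-* f f) ⟩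
        ℤ.∣ + f ℤ.* + f ℤ.- + f ∣    ≡⟨ cong ℤ.∣_∣ (factor (+ f)) ⟩
        ℤ.∣ + f ℤ.* (+ f ℤ.- + 1) ∣  ≡⟨ ℤP.abs-* (+ f) (+ f ℤ.- + 1) ⟩
        f * ℤ.∣ + f ℤ.- + 1 ∣        ∎
        where open ≡-Reasoning
    at-I : ∀ i → i ∈ I → (+ f) ≡ + 0 [mod pe i ]
    at-I i i∈I = subst (pe i ∣_) (sym (+-identityʳ f))
      (prime^-cancel (p-prime i) p∤f-1 (e i) f (subst (pe i ∣_) (*-comm f _) (pe∣f[f-1] i)))
      where
      p∤f-1 : ¬ p i ∣ ℤ.∣ (+ f) ℤ.- + 1 ∣
      p∤f-1 p∣f-1 = prime∤1 (p-prime i)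
        (Equivalence.to (mod-divisors (+ f) (+ 1) ∣-refl p∣f-1) (Equivalence.to (f-support i) i∈I))
    off-I : ∀ i → i ∉ I → (+ f) ≡ + 1 [mod pe i ]
    off-I i i∉I = prime^-cancel (p-prime i) (λ p∣f → i∉I (Equivalence.from (f-support i) p∣f))
                                (e i) _ (pe∣f[f-1] i)

  power-support : ∀ {c} k → Support c → Support (c ^ suc k % m)
  power-support {c} k c-support i = ⇔-trans (c-support i)
    (⇔-trans (⇔-sym (prime∣^⇔∣ (p-prime i) c {suc k} (s≤s z≤n)))
             (⇔-sym (mod-divisors (+ (c ^ suc k % m)) (+ (c ^ suc k)) (p∣m i) (mod-reduce m (c ^ suc k)))))

  -- If c has support I, its idempotent power is d_I, and the powers of c lead from c to it.
  support⇒connected : ∀ {d c} → IsIdempotentD r p e I d → c < m → Support c → SPConnected m d c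
  support⇒connected {d} {c} (d<m , d-local) c<m c-support with Powers.idempotent-power m c
  ... | k , f²≡f = subst (SPConnected m d) P1≡c (connected-to-P1 k (subst (SPConnected m d) d≡f here))
    where
    open Powers m c
    f : ℕ
    f = P (suc k)
    f≡f² : (+ f) ≡ + (f * f) [mod m ]
    f≡f² = subst (λ z → (+ z) ≡ + (f * f) [mod m ]) f²≡f (mod-reduce m (f * f))
    d≡f : d ≡ f
    d≡f = locallyIdempotent-unique d<m (m%n<n _ m) d-local
            (idempotent-locallyIdempotent (power-support k c-support) f≡f²)
    P1≡c : P 1 ≡ c
    P1≡c = trans (cong (_% m) (*-identityʳ c)) (m<n⇒m%n≡m c<m)

mainTheorem5 : (r : ℕ) (p e : Fin r → ℕ)
    → (∀ i → Prime (p i)) → Injective _≡_ _≡_ p → (∀ i → 1 ≤ e i)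
    → (I : Subset r) (d : ℕ) → IsIdempotentD r p e I d
    → (c : ℕ) → c < modulus r p e
    → SPConnected (modulus r p e) d c
      ⇔ (Σ ℤ λ x → (∀ k → gI r p e I * k ≡ modulus r p e → gcdℤ x (+ k) ≡ + 1)
           × (+ c) ≡ (+ piI r p I) ℤ.* x [mod modulus r p e ])
mainTheorem5 r p e p-prime p-inj e≥1 I d dI c c<m =
  mk⇔ (λ d~c  → support⇒unitMultiple (connected-support dI d~c))
      (λ c≡πx → support⇒connected dI c<m (unitMultiple⇒support c≡πx))
  where open Component r p e p-prime p-inj e≥1 I
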